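{- Let $\Theta=(\Sigma,\mathit{sim},\mathit{ser})$ be a comtrace alphabet with $\mathit{sim}\setminus\mathit{ser}=\emptyset$ (a radical comtrace alphabet), let $\tau$ be a comtrace over $\Theta$ and let $\sigma$ be the step trace over the concurrent alphabet $(\Sigma,\mathit{ind})$ containing some (equivalently every) step sequence of $\tau$. Then $(\Sigma\times\Sigma)\setminus\mathit{ind}=\mathit{dep}$ and $\Pi^\perp_\tau=\Pi_\sigma$, i.e. $\Pi^\perp_{a,b}(\tau)=\Pi_{a,b}(\sigma)$ for every $(a,b)\in\mathit{dep}$.
   Context: A comtrace alphabet is $\Theta=(\Sigma,\mathit{sim},\mathit{ser})$ with $\Sigma$ finite nonempty, $\mathit{ser}\subseteq\mathit{sim}\subseteq\Sigma\times\Sigma$, $\mathit{sim}$ irreflexive and symmetric; steps are nonempty $A\subseteq\Sigma$ with $(a,b)\in\mathit{sim}$ for distinct $a,b\in A$; comtraces are classes of the reflexive, symmetric, transitive closure of $uABz\sim u(A\cup B)z$ for steps with $A\times B\subseteq\mathit{ser}$. $\mathit{dep}=(\Sigma\times\Sigma)\setminus\mathit{sim}$, $\mathit{ind}=\mathit{ser}\cap\mathit{ser}^{ -1}$, $\mathit{ssm}=\mathit{sim}\setminus(\mathit{ser}\cup\mathit{ser}^{ -1})$, $\mathit{wdp}=\mathit{ser}^{ -1}\setminus\mathit{ser}$. Comtrace projections (fresh symbol $\perp$): for $(a,b)\notin\mathit{ind}$ and step $A$, $\Pi^\perp_{a,b}(A)=\epsilon$ if $\{a,b\}\cap A=\emptyset$;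 $a$ if $a\in A,b\notin A$; $b$ if $b\in A,a\notin A$; $a$ if $a=b\in A$; for distinct $a,b\in A$: $ba$ if $(a,b)\in\mathit{wdp}$, $ab$ if $(b,a)\in\mathit{wdp}$, $\perp$ if $(a,b)\in\mathit{ssm}$; concatenated over steps, and $\Pi^\perp_\tau(a,b)=\Pi^\perp_{a,b}(w)$ for $w\in\tau$. Step traces over a concurrent alphabet $(\Sigma,I)$ ($I$ irreflexive symmetric): steps are nonempty sets of pairwise $I$-related actions, and step traces are classes of the reflexive, symmetric, transitive closure of $uABz\sim u(A\cup B)z$ for $A\times B\subseteq I$. For $(a,b)$ not in $I$ (possibly $a=b$), $\Pi_{a,b}$ maps a step sequence to a word: $\Pi_{a,b}(Aw)=a\Pi_{a,b}(w)$ if $a\in A$, $b\Pi_{a,b}(w)$ if $b\in A$, $\Pi_{a,b}(w)$ otherwise, and $\Pi_{a,b}(\text{empty})=\epsilon$; $\Pi_\sigma(a,b)=\Pi_{a,b}(w)$ for $w\in\sigma$. -}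

module Defs where

open import Data.Nat using (ℕ; _≤_)
open import Data.Bool using (Bool; true; false; _∧_; not; if_then_else_)
open import Data.Fin using (Fin; _≟_)
open import Data.Fin.Subset using (Subset; _∈_; _∪_; Nonempty)
open import Data.Vec using (lookup)
open import Data.List using (List; []; _∷_; _++_)
open import Data.List.Relation.Unary.All using (All)
open import Data.Maybe using (Maybe; just; nothing)
open import Data.Product using (_×_)
open import Relation.Nullary using (¬_; yes; no)
open import Relation.Binary.PropositionalEquality using (_≡_; _≢_)
open import Relation.Binary.Construct.Closure.Equivalence using (EqClosure)

BRel : ℕ → Set
BRel n = Fin n → Fin n → Bool

record ComtraceAlphabet : Set where
  field
    size     : ℕ
    nonempty : 1 ≤ size
    sim      : BRel size
    ser      : BRel size
    ser⊆sim  : ∀ a b → ser a b ≡ true → sim a b ≡ true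
    sim-irr  : ∀ a → sim a a ≡ false
    sim-sym  : ∀ a b → sim a b ≡ sim b a

module _ {n : ℕ} where

  ind : BRel n → BRel n
  ind ser a b = ser a b ∧ ser b a

  ssm : BRel n → BRel n → BRel n
  ssm sim ser a b = sim a b ∧ not (ser a b) ∧ not (ser b a)

  wdp : BRel n → BRel n
  wdp ser a b = ser b a ∧ not (ser a b)

  IsStep : BRel n → Subset n → Set
  IsStep R A = Nonempty A × (∀ a b → a ∈ A → b ∈ A → a ≢ b → R a b ≡ true)

  StepSeq : Set
  StepSeq = List (Subset n)

  IsStepSeq : BRel n → StepSeq → Set
  IsStepSeq R w = All (IsStep R) w

  data Merge (S R : BRel n) : StepSeq → StepSeq → Set where
    merge : ∀ u A B z → IsStep S A → IsStep S B →
            (∀ a b → a ∈ A → b ∈ B → R a b ≡ true) →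
            Merge S R (u ++ A ∷ B ∷ z) (u ++ (A ∪ B) ∷ z)

  _≈[_,_]_ : StepSeq → BRel n → BRel n → StepSeq → Set
  w ≈[ sim , ser ] w' = EqClosure (Merge sim ser) w w'

  _≈ˢ[_]_ : StepSeq → BRel n → StepSeq → Set
  w ≈ˢ[ I ] w' = EqClosure (Merge I I) w w'

  -- Comtrace projection Π^⊥_{a,b} on a step; ⊥ is represented by 'nothing'.
  -- (Only meaningful for (a,b) ∉ ind; the remaining case returns [] arbitrarily.)
  projStep⊥ : BRel n → BRel n → Fin n → Fin n → Subset n → List (Maybe (Fin n))
  projStep⊥ sim ser a b A with lookup A a | lookup A b | a ≟ b
  ... | false | false | _     = []
  ... | true  | false | _     = just a ∷ []
  ... | false | true  | _     = just b ∷ []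
  ... | true  | true  | yes _ = just a ∷ []
  ... | true  | true  | no _  =
    if wdp ser a b then just b ∷ just a ∷ []
    else if wdp ser b a then just a ∷ just b ∷ []
    else if ssm sim ser a b then nothing ∷ []
    else []

  proj⊥ : BRel n → BRel n → Fin n → Fin n → StepSeq → List (Maybe (Fin n))
  proj⊥ sim ser a b []      = []
  proj⊥ sim ser a b (A ∷ w) = projStep⊥ sim ser a b A ++ proj⊥ sim ser a b w

  proj : Fin n → Fin n → StepSeq → List (Fin n)
  proj a b []      = []
  proj a b (A ∷ w) =
    if lookup A a then a ∷ proj a b w
    else if lookup A b then b ∷ proj a b w
    else proj a b w

dep : ∀ {n} → BRel n → Fin n → Fin n → Set
dep sim a b = sim a b ≡ false

-- In a radical alphabet ser = sim, so ind = sim and the complement of ind is exactly dep.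
-- For (a,b) ∈ dep no step contains both a and b, so on step sequences Π^⊥_{a,b} is Π_{a,b}
-- with every letter wrapped in just. Merging two steps A, B with A × B ⊆ sim never merges an
-- occurrence of a or b in A with one in B, so Π_{a,b} is invariant under both the comtrace and
-- the step-trace equivalence; and comtrace equivalence preserves being a step sequence.
module Submission where

open import Defs
open import Data.Nat using (ℕ)
open import Data.Bool using (true; false; _∨_; if_then_else_)
open import Data.Bool.Properties using (∧-conicalˡ; ¬-not; not-¬)
open import Data.Fin using (Fin; _≟_)
open import Data.Fin.Subset using (Subset; _∈_; _∪_)
open import Data.Fin.Subset.Properties using (x∈p∪q⁻; p⊆p∪q)
open import Data.Vec using (lookup)
open import Data.Vec.Properties using (lookup-zipWith; lookup⇒[]=)
open import Data.List using (map; []; _∷_; _++_)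
open import Data.List.Relation.Unary.All using ([]; _∷_)
open import Data.List.Relation.Unary.All.Properties using (++⁺; ++⁻)
open import Data.Maybe using (just)
open import Data.Product using (_×_; _,_; proj₂)
open import Data.Sum using (inj₁; inj₂)
open import Data.Empty using (⊥; ⊥-elim)
open import Relation.Nullary using (¬_; yes; no)
open import Relation.Binary.Core using (_=[_]⇒_)
open import Relation.Binary.PropositionalEquality
  using (_≡_; refl; sym; trans; cong; isEquivalence; module ≡-Reasoning)
open import Relation.Binary.Construct.Closure.Equivalence using (EqClosure; gfold)
open import Function.Bundles using (_⇔_; mk⇔; Equivalence)
open import Function.Properties.Equivalence using (⇔-isEquivalence)

private
  true≢false : true ≡ false → ⊥
  true≢false ()

module _ {n : ℕ} where

  lookup⇒∈ : ∀ {A : Subset n} {x} → lookup A x ≡ true → x ∈ A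
  lookup⇒∈ {A} {x} = lookup⇒[]= x A

  lookup-∪ : ∀ (A B : Subset n) x → lookup (A ∪ B) x ≡ (lookup A x ∨ lookup B x)
  lookup-∪ A B x = lookup-zipWith _∨_ x A B

  module _ {S : BRel n} (S-sym : ∀ x y → S x y ≡ S y x) where

    IsStep-∪ : ∀ {A B} → IsStep S A → IsStep S B →
               (∀ x y → x ∈ A → y ∈ B → S x y ≡ true) → IsStep S (A ∪ B)
    IsStep-∪ {A} {B} ((x , x∈A) , A-step) (_ , B-step) A×B⊆S = (x , p⊆p∪q B x∈A) , pairwise
      where
      pairwise : ∀ p q → p ∈ A ∪ B → q ∈ A ∪ B → ¬ p ≡ q → S p q ≡ true
      pairwise p q p∈ q∈ p≢q with x∈p∪q⁻ A B p∈ | x∈p∪q⁻ A B q∈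
      ... | inj₁ p∈A | inj₁ q∈A = A-step p q p∈A q∈A p≢q
      ... | inj₂ p∈B | inj₂ q∈B = B-step p q p∈B q∈B p≢q
      ... | inj₁ p∈A | inj₂ q∈B = A×B⊆S p q p∈A q∈B
      ... | inj₂ p∈B | inj₁ q∈A = trans (S-sym p q) (A×B⊆S q p q∈A p∈B)

    IsStepSeq-Merge : ∀ {R : BRel n} → (∀ x y → R x y ≡ true → S x y ≡ true) →
                      ∀ {w w′} → Merge S R w w′ → IsStepSeq S w ⇔ IsStepSeq S w′
    IsStepSeq-Merge R⊆S (merge u A B z A-step B-step A×B⊆R) = mk⇔ to from
      where
      to : IsStepSeq S (u ++ A ∷ B ∷ z) → IsStepSeq S (u ++ (A ∪ B) ∷ z)
      to valid with ++⁻ u valid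
      ... | u-valid , _ ∷ _ ∷ z-valid =
        ++⁺ u-valid (IsStep-∪ A-step B-step (λ x y x∈A y∈B → R⊆S x y (A×B⊆R x y x∈A y∈B)) ∷ z-valid)

      from : IsStepSeq S (u ++ (A ∪ B) ∷ z) → IsStepSeq S (u ++ A ∷ B ∷ z)
      from valid with ++⁻ u valid
      ... | u-valid , _ ∷ z-valid = ++⁺ u-valid (A-step ∷ B-step ∷ z-valid)

    IsStepSeq-resp-EqClosure : ∀ {R : BRel n} → (∀ x y → R x y ≡ true → S x y ≡ true) →
                               EqClosure (Merge S R) =[ IsStepSeq S ]⇒ _⇔_
    IsStepSeq-resp-EqClosure R⊆S = gfold ⇔-isEquivalence (IsStepSeq S) (IsStepSeq-Merge R⊆S)

  proj⊥≡map-just∘proj : ∀ {sim : BRel n} ser {a b} → dep sim a b →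
                        ∀ {w} → IsStepSeq sim w → proj⊥ sim ser a b w ≡ map just (proj a b w)
  proj⊥≡map-just∘proj ser {a} {b} ab-dep {[]} [] = refl
  proj⊥≡map-just∘proj ser {a} {b} ab-dep {A ∷ w} (A-step ∷ w-valid)
    with proj⊥≡map-just∘proj ser ab-dep w-valid | lookup A a in a∈A | lookup A b in b∈A | a ≟ b
  ... | ih | false | false | _     = ih
  ... | ih | true  | false | _     = cong (just a ∷_) ih
  ... | ih | false | true  | _     = cong (just b ∷_) ih
  ... | ih | true  | true  | yes _ = cong (just a ∷_) ih
  ... | ih | true  | true  | no a≢b =
    ⊥-elim (true≢false (trans (sym (proj₂ A-step a b (lookup⇒∈ a∈A) (lookup⇒∈ b∈A) a≢b)) ab-dep))

  proj-++ˡ : ∀ {a b} (u : StepSeq {n}) {x y : StepSeq {n}} →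
             proj a b x ≡ proj a b y → proj a b (u ++ x) ≡ proj a b (u ++ y)
  proj-++ˡ [] e = e
  proj-++ˡ {a} {b} (C ∷ u) e =
    cong (λ p → if lookup C a then a ∷ p else if lookup C b then b ∷ p else p) (proj-++ˡ u e)

  module _ {sim : BRel n}
           (sim-irr : ∀ x → sim x x ≡ false) (sim-sym : ∀ x y → sim x y ≡ sim y x)
           {a b : Fin n} (ab-dep : dep sim a b) where

    private
      sim-across : ∀ {A B : Subset n} → (∀ x y → x ∈ A → y ∈ B → sim x y ≡ true) →
                   ∀ {x y} → lookup A x ≡ true → lookup B y ≡ true → sim x y ≡ false → ⊥
      sim-across A×B⊆sim {x} {y} x∈A y∈B xy-dep =
        true≢false (trans (sym (A×B⊆sim x y (lookup⇒∈ x∈A) (lookup⇒∈ y∈B))) xy-dep)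

    proj-∪ : ∀ (A B : Subset n) z → (∀ x y → x ∈ A → y ∈ B → sim x y ≡ true) →
             proj a b (A ∷ B ∷ z) ≡ proj a b ((A ∪ B) ∷ z)
    proj-∪ A B z A×B⊆sim rewrite lookup-∪ A B a | lookup-∪ A B b
      with lookup A a in a∈A | lookup A b in b∈A | lookup B a in a∈B | lookup B b in b∈B
    ... | true  | _     | true  | _     = ⊥-elim (sim-across A×B⊆sim a∈A a∈B (sim-irr a))
    ... | true  | _     | false | true  = ⊥-elim (sim-across A×B⊆sim a∈A b∈B ab-dep)
    ... | true  | _     | false | false = refl
    ... | false | true  | true  | _     = ⊥-elim (sim-across A×B⊆sim b∈A a∈B (trans (sim-sym b a) ab-dep))
    ... | false | true  | false | true  = ⊥-elim (sim-across A×B⊆sim b∈A b∈B (sim-irr b))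
    ... | false | true  | false | false = refl
    ... | false | false | true  | _     = refl
    ... | false | false | false | true  = refl
    ... | false | false | false | false = refl

    proj-resp-Merge : ∀ {S R : BRel n} → (∀ x y → R x y ≡ true → sim x y ≡ true) →
                      ∀ {w w′} → Merge S R w w′ → proj a b w ≡ proj a b w′
    proj-resp-Merge R⊆sim (merge u A B z _ _ A×B⊆R) =
      proj-++ˡ u {A ∷ B ∷ z} {(A ∪ B) ∷ z} (proj-∪ A B z (λ x y x∈A y∈B → R⊆sim x y (A×B⊆R x y x∈A y∈B)))

    proj-resp-EqClosure : ∀ {S R : BRel n} → (∀ x y → R x y ≡ true → sim x y ≡ true) →
                          EqClosure (Merge S R) =[ proj a b ]⇒ _≡_
    proj-resp-EqClosure R⊆sim = gfold isEquivalence (proj a b) (proj-resp-Merge R⊆sim)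

theorem4p13 : (Θ : ComtraceAlphabet) →
    let open ComtraceAlphabet Θ in
    (∀ a b → sim a b ≡ true → ser a b ≡ true) →
    ((∀ a b → (¬ (ind ser a b ≡ true)) ⇔ dep sim a b) ×
     (∀ (w v w′ u : StepSeq {size}) →
        IsStepSeq sim w →
        v ≈[ sim , ser ] w →
        w′ ≈[ sim , ser ] w →
        u ≈ˢ[ ind ser ] v →
        ∀ a b → dep sim a b →
        proj⊥ sim ser a b w′ ≡ map just (proj a b u)))
theorem4p13 Θ sim⊆ser = ¬ind⇔dep , Π⊥≡Π
  where
  open ComtraceAlphabet Θ
  open ≡-Reasoning

  ind≡sim : ∀ a b → ind ser a b ≡ sim a b
  ind≡sim a b with sim a b in ab-sim
  ... | true  rewrite sim⊆ser a b ab-sim | sim⊆ser b a (trans (sim-sym b a) ab-sim) = refl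
  ... | false with ser a b in ab-ser
  ...   | false = refl
  ...   | true  = ⊥-elim (true≢false (trans (sym (ser⊆sim a b ab-ser)) ab-sim))

  ¬ind⇔dep : ∀ a b → (¬ (ind ser a b ≡ true)) ⇔ dep sim a b
  ¬ind⇔dep a b rewrite ind≡sim a b = mk⇔ ¬-not not-¬

  ind⊆sim : ∀ x y → ind ser x y ≡ true → sim x y ≡ true
  ind⊆sim x y xy-ind = ser⊆sim x y (∧-conicalˡ (ser x y) (ser y x) xy-ind)

  Π⊥≡Π : ∀ (w v w′ u : StepSeq {size}) → IsStepSeq sim w →
         v ≈[ sim , ser ] w → w′ ≈[ sim , ser ] w → u ≈ˢ[ ind ser ] v →
         ∀ a b → dep sim a b → proj⊥ sim ser a b w′ ≡ map just (proj a b u)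
  Π⊥≡Π w v w′ u w-valid v≈w w′≈w u≈v a b ab-dep = begin
    proj⊥ sim ser a b w′   ≡⟨ proj⊥≡map-just∘proj ser ab-dep w′-valid ⟩
    map just (proj a b w′) ≡⟨ cong (map just) (trans (proj-resp-≈ w′≈w) (sym (proj-resp-≈ v≈w))) ⟩
    map just (proj a b v)  ≡⟨ cong (map just) (sym (proj-resp-≈ˢ u≈v)) ⟩
    map just (proj a b u)  ∎
    where
    w′-valid : IsStepSeq sim w′
    w′-valid = Equivalence.from (IsStepSeq-resp-EqClosure sim-sym ser⊆sim w′≈w) w-valid

    proj-resp-≈ : ∀ {x y} → x ≈[ sim , ser ] y → proj a b x ≡ proj a b y
    proj-resp-≈ = proj-resp-EqClosure sim-irr sim-sym ab-dep ser⊆sim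

    proj-resp-≈ˢ : ∀ {x y} → x ≈ˢ[ ind ser ] y → proj a b x ≡ proj a b y
    proj-resp-≈ˢ = proj-resp-EqClosure sim-irr sim-sym ab-dep ind⊆sim
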